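{- Let $k \geq 3$ and let $T_h^k$ be the perfect $k$-ary tree of height $h = 3m + t \geq 3$, with $0 \leq t \leq 2$. Let $S \subseteq V(T_h^k)$ consist of: (1) all vertices at depth $h-1$; (2) all vertices at depths $h-2, h-5, \dots, 1+t$ (i.e. all depths $j$ with $1+t \le j \le h-2$ and $j \equiv h-2 \pmod 3$); (3) the root when $t = 1$, and the $k$ vertices at depth $1$ when $t = 2$. Then $S$ is a multicover of $T_h^k$.
   Context: For a graph $G$, $d(u,v)$ is the distance, $\mathrm{ecc}(v)$ the eccentricity of $v$, and $N_r[v] = \{u : d(u,v) \le r\}$. A multicover of $G$ is a set $S \subseteq V(G)$ such that $|N_r[v]\cap S| \ge r$ for every $v \in V(G)$ and every $1 \le r \le \mathrm{ecc}(v)$. The perfect $k$-ary tree $T_h^k$ is the rooted tree in which every non-leaf vertex has exactly $k$ children and all leaves are at distance $h$ from the root; the depth of a vertex is its distance from the root (the paper calls this its height/level). -}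

module Defs where

open import Data.Nat using (ℕ; zero; suc; _+_; _*_; _∸_; _≤_; _≤ᵇ_; _≡ᵇ_; _%_; _⊔_)
open import Data.Nat.Properties using (_≤?_)
open import Data.Fin using (Fin)
open import Data.Fin.Properties using () renaming (_≟_ to _≟ᶠ_)
open import Data.List using (List; []; _∷_; length; map; concatMap; filter; foldr)
open import Data.List.Base using (allFin)
open import Data.Bool using (Bool; true; false; _∧_; _∨_; T)
open import Data.Bool.Properties using (T?)
open import Relation.Nullary using (does)

-- A vertex of the perfect k-ary tree T_h^k is the path from the root,
-- i.e. a list of child indices (Fin k) of length ≤ h.  Its depth is its length.

vertices : (k h : ℕ) → List (List (Fin k))
vertices k zero    = [] ∷ []
vertices k (suc h) = [] ∷ concatMap (λ i → map (i ∷_) (vertices k h)) (allFin k)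

depth : ∀ {k} → List (Fin k) → ℕ
depth = length

lca-depth : ∀ {k} → List (Fin k) → List (Fin k) → ℕ
lca-depth (a ∷ u) (b ∷ v) with does (a ≟ᶠ b)
... | true  = suc (lca-depth u v)
... | false = zero
lca-depth _ _ = zero

dist : ∀ {k} → List (Fin k) → List (Fin k) → ℕ
dist u v = (depth u ∸ lca-depth u v) + (depth v ∸ lca-depth u v)

max : List ℕ → ℕ
max = foldr _⊔_ 0

ecc : (k h : ℕ) → List (Fin k) → ℕ
ecc k h v = max (map (dist v) (vertices k h))

countBall : (k h : ℕ) → (List (Fin k) → Bool) → List (Fin k) → ℕ → ℕ
countBall k h S v r =
  length (filter (λ u → T? ((dist v u ≤ᵇ r) ∧ S u)) (vertices k h))

IsMulticover : (k h : ℕ) → (List (Fin k) → Bool) → Set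
IsMulticover k h S =
  ∀ (v : List (Fin k)) → length v ≤ h →
  ∀ (r : ℕ) → 1 ≤ r → r ≤ ecc k h v → r ≤ countBall k h S v r

inS-depth : (h t d : ℕ) → Bool
inS-depth h t d =
     (d ≡ᵇ (h ∸ 1))
  ∨ ((suc t ≤ᵇ d) ∧ (d ≤ᵇ (h ∸ 2)) ∧ ((d % 3) ≡ᵇ ((h ∸ 2) % 3)))
  ∨ ((t ≡ᵇ 1) ∧ (d ≡ᵇ 0))
  ∨ ((t ≡ᵇ 2) ∧ (d ≡ᵇ 1))

theSet : (k h t : ℕ) → List (Fin k) → Bool
theSet k h t v = inS-depth h t (depth v)

module Submission where

-- S-vertices near v are counted in cones: all vertices at one depth below an ancestor of v.
-- A cone of height x whose apex is y steps above v has k ^ x ≥ 3 ^ x vertices, all within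
-- distance x + y of v.  The S-depths begin at depth 0 or 1, never skip three consecutive
-- depths below h - 1, and contain h - 2 and h - 1.  If the ball of radius r around v stays
-- above depth h - 1, it contains a full S-level at least r - 2 below v, and 3 ^ (r - 2) ≥ r
-- for r ≥ 3.  Otherwise climb as far as r allows and descend to depth h - 1: the cone has
-- height x with r ≤ 2x + 1 (r ≤ 2x + 2 at a leaf), again at most 3 ^ x.  Radii 1 and 2 are
-- read off the S-depths next to v, and a leaf with r = 2 or r = 4 needs two cones.

open import Defs
open import Data.Nat using (ℕ; zero; suc; _+_; _*_; _∸_; _^_; _≤_; _<_; _≤ᵇ_; _≡ᵇ_; z≤n; s≤s)
open import Data.Nat.Properties
open import Data.Fin using (Fin)
open import Data.Fin.Properties using () renaming (_≟_ to _≟ᶠ_)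
open import Data.List using (List; []; _∷_; length; map; concatMap; filterᵇ; _++_; take; allFin)
open import Data.List.Properties using (length-++; filter-++; length-tabulate; length-take; foldr-preservesᵇ)
open import Data.List.Relation.Unary.All as All using (All; []; _∷_)
open import Data.List.Relation.Unary.All.Properties using (concat⁺; map⁺)
open import Data.List.Relation.Unary.Any using (here; there)
open import Data.List.Membership.Propositional using (_∈_)
open import Data.List.Membership.Propositional.Properties using (∈-allFin)
open import Data.Bool using (Bool; true; false; _∧_; T)
open import Data.Bool.Properties using (T?; T-∧; T-∨)
open import Data.Product using (_,_; proj₁; proj₂; _×_; ∃₂; ∃-syntax)
open import Data.Sum using (_⊎_; inj₁; inj₂)
open import Function using (_∘_; id)
open import Function.Bundles using (Equivalence)
open import Data.Unit using (tt)
open import Data.Empty using (⊥-elim)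
open import Relation.Nullary using (¬_; does; yes; no)
open import Relation.Nullary.Decidable using (dec-true)
open import Data.Nat.DivMod using ([m+kn]%n≡m%n)
open import Data.Nat.Tactic.RingSolver using (solve-∀)
open import Relation.Binary.PropositionalEquality

count : ∀ {A : Set} → (A → Bool) → List A → ℕ
count f xs = length (filterᵇ f xs)

module _ {A : Set} where

  count-∷-≥ : ∀ (f : A → Bool) x xs → count f xs ≤ count f (x ∷ xs)
  count-∷-≥ f x xs with f x
  ... | true  = n≤1+n _
  ... | false = ≤-refl

  count-++ : ∀ (f : A → Bool) xs ys → count f (xs ++ ys) ≡ count f xs + count f ys
  count-++ f xs ys = trans (cong length (filter-++ (T? ∘ f) xs ys)) (length-++ (filterᵇ f xs))

  count-mono : ∀ {f g : A → Bool} → (∀ x → T (f x) → T (g x)) → ∀ xs → count f xs ≤ count g xs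
  count-mono f⇒g [] = z≤n
  count-mono {f} {g} f⇒g (x ∷ xs) with f x | g x | f⇒g x
  ... | true  | true  | _   = s≤s (count-mono f⇒g xs)
  ... | true  | false | imp = ⊥-elim (imp tt)
  ... | false | true  | _   = m≤n⇒m≤1+n (count-mono f⇒g xs)
  ... | false | false | _   = count-mono f⇒g xs

  count-disjoint : ∀ {f g h : A → Bool} → (∀ x → T (f x) → ¬ T (g x)) →
    (∀ x → T (f x) → T (h x)) → (∀ x → T (g x) → T (h x)) →
    ∀ xs → count f xs + count g xs ≤ count h xs
  count-disjoint f#g f⇒h g⇒h [] = z≤n
  count-disjoint {f} {g} {h} f#g f⇒h g⇒h (x ∷ xs)
    with ih ← count-disjoint f#g f⇒h g⇒h xs | f x | g x | h x | f#g x | f⇒h x | g⇒h x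
  ... | true  | true  | _     | f#g′ | _    | _    = ⊥-elim (f#g′ tt tt)
  ... | true  | false | true  | _    | _    | _    = s≤s ih
  ... | false | true  | true  | _    | _    | _    = subst (_≤ suc (count h xs)) (sym (+-suc _ _)) (s≤s ih)
  ... | false | false | true  | _    | _    | _    = m≤n⇒m≤1+n ih
  ... | false | false | false | _    | _    | _    = ih
  ... | true  | _     | false | _    | f⇒h′ | _    = ⊥-elim (f⇒h′ tt)
  ... | false | true  | false | _    | _    | g⇒h′ = ⊥-elim (g⇒h′ tt)

  count-map : ∀ {B : Set} (f : B → Bool) (g : A → B) xs → count f (map g xs) ≡ count (λ x → f (g x)) xs
  count-map f g [] = refl
  count-map f g (x ∷ xs) with f (g x)
  ... | true  = cong suc (count-map f g xs)
  ... | false = count-map f g xs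

module Tree (k : ℕ) where

  Vertex : Set
  Vertex = List (Fin k)

  subtrees : List Vertex → List (Fin k) → List Vertex
  subtrees vs = concatMap (λ i → map (i ∷_) vs)

  count-subtrees-∷ : ∀ (f : Vertex → Bool) vs i is →
    count f (subtrees vs (i ∷ is)) ≡ count (λ u → f (i ∷ u)) vs + count f (subtrees vs is)
  count-subtrees-∷ f vs i is =
    trans (count-++ f (map (i ∷_) vs) (subtrees vs is)) (cong (_+ _) (count-map f (i ∷_) vs))

  count-subtree-≤ : ∀ (f : Vertex → Bool) vs {a is} → a ∈ is →
    count (λ u → f (a ∷ u)) vs ≤ count f (subtrees vs is)
  count-subtree-≤ f vs {a} {.a ∷ is} (here refl) =
    ≤-trans (m≤m+n _ _) (≤-reflexive (sym (count-subtrees-∷ f vs a is)))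
  count-subtree-≤ f vs {a} {i ∷ is} (there a∈is) =
    ≤-trans (count-subtree-≤ f vs a∈is) (≤-trans (m≤n+m _ _) (≤-reflexive (sym (count-subtrees-∷ f vs i is))))

  count-subtrees-≥ : ∀ (f : Vertex → Bool) vs c → (∀ i → c ≤ count (λ u → f (i ∷ u)) vs) →
    ∀ is → length is * c ≤ count f (subtrees vs is)
  count-subtrees-≥ f vs c c≤ [] = z≤n
  count-subtrees-≥ f vs c c≤ (i ∷ is) =
    ≤-trans (+-mono-≤ (c≤ i) (count-subtrees-≥ f vs c c≤ is)) (≤-reflexive (sym (count-subtrees-∷ f vs i is)))

  count-child-≤ : ∀ h (f : Vertex → Bool) a →
    count (λ u → f (a ∷ u)) (vertices k h) ≤ count f (vertices k (suc h))
  count-child-≤ h f a = ≤-trans (count-subtree-≤ f (vertices k h) (∈-allFin a)) (count-∷-≥ f [] _)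

  count-children-≥ : ∀ h (f : Vertex → Bool) c → (∀ i → c ≤ count (λ u → f (i ∷ u)) (vertices k h)) →
    k * c ≤ count f (vertices k (suc h))
  count-children-≥ h f c c≤ = begin
    k * c                                           ≡⟨ cong (_* c) (sym (length-tabulate {n = k} id)) ⟩
    length (allFin k) * c                           ≤⟨ count-subtrees-≥ f (vertices k h) c c≤ (allFin k) ⟩
    count f (subtrees (vertices k h) (allFin k))    ≤⟨ count-∷-≥ f [] _ ⟩
    count f (vertices k (suc h))                    ∎
    where open ≤-Reasoning

  _⊑_ : Vertex → Vertex → Bool
  []      ⊑ u       = true
  (a ∷ p) ⊑ []      = false
  (a ∷ p) ⊑ (b ∷ u) = does (a ≟ᶠ b) ∧ (p ⊑ u)

  descendantAt : Vertex → ℕ → Vertex → Bool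
  descendantAt p e u = (p ⊑ u) ∧ (length u ≡ᵇ e)

  descendants-count : ∀ h p e → length p ≤ e → e ≤ h →
    k ^ (e ∸ length p) ≤ count (descendantAt p e) (vertices k h)
  descendants-count zero    []      zero    _         _         = s≤s z≤n
  descendants-count (suc h) []      zero    _         _         = s≤s z≤n
  descendants-count (suc h) []      (suc e) _         (s≤s e≤h) =
    count-children-≥ h (descendantAt [] (suc e)) (k ^ e) (λ _ → descendants-count h [] e z≤n e≤h)
  descendants-count (suc h) (a ∷ p) (suc e) (s≤s p≤e) (s≤s e≤h) = begin
    k ^ (e ∸ length p)                                          ≤⟨ descendants-count h p e p≤e e≤h ⟩
    count (descendantAt p e) (vertices k h)                      ≤⟨ count-mono extend (vertices k h) ⟩
    count (λ u → descendantAt (a ∷ p) (suc e) (a ∷ u)) (vertices k h) ≤⟨ count-child-≤ h (descendantAt (a ∷ p) (suc e)) a ⟩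
    count (descendantAt (a ∷ p) (suc e)) (vertices k (suc h))   ∎
    where
    open ≤-Reasoning
    extend : ∀ u → T (descendantAt p e u) → T (descendantAt (a ∷ p) (suc e) (a ∷ u))
    extend u below rewrite dec-true (a ≟ᶠ a) refl = below

  ⊑-≤-lca-depth : ∀ p v u → T (p ⊑ v) → T (p ⊑ u) → length p ≤ lca-depth v u
  ⊑-≤-lca-depth []      v       u       _   _   = z≤n
  ⊑-≤-lca-depth (a ∷ p) (b ∷ v) (c ∷ u) p⊑v p⊑u with a ≟ᶠ b | a ≟ᶠ c
  ... | yes refl | yes refl rewrite dec-true (a ≟ᶠ a) refl = s≤s (⊑-≤-lca-depth p v u p⊑v p⊑u)

  take-⊑ : ∀ c v → T (take c v ⊑ v)
  take-⊑ zero    v       = tt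
  take-⊑ (suc c) []      = tt
  take-⊑ (suc c) (a ∷ v) rewrite dec-true (a ≟ᶠ a) refl = take-⊑ c v

  dist-≤-through : ∀ p v u → T (p ⊑ v) → T (p ⊑ u) →
    dist v u ≤ (length v ∸ length p) + (length u ∸ length p)
  dist-≤-through p v u p⊑v p⊑u = +-mono-≤ (∸-monoʳ-≤ (length v) p≤lca) (∸-monoʳ-≤ (length u) p≤lca)
    where p≤lca = ⊑-≤-lca-depth p v u p⊑v p⊑u

  vertices-depth : ∀ h → All (λ u → length u ≤ h) (vertices k h)
  vertices-depth zero    = z≤n ∷ []
  vertices-depth (suc h) =
    z≤n ∷ concat⁺ (map⁺ (All.universal (λ i → map⁺ (All.map s≤s (vertices-depth h))) (allFin k)))

  ecc-≤ : ∀ h v → ecc k h v ≤ length v + h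
  ecc-≤ h v = foldr-preservesᵇ {P = _≤ length v + h} ⊔-lub z≤n (map⁺ (All.map (λ {u} u≤h → +-mono-≤
      (m∸n≤m (length v) (lca-depth v u)) (≤-trans (m∸n≤m (length u) (lca-depth v u)) u≤h)) (vertices-depth h)))

module Cones (k h : ℕ) (P : ℕ → Bool) where
  open Tree k

  ball : Vertex → ℕ → ℕ
  ball v r = countBall k h (λ u → P (length u)) v r

  -- The vertices at depth down + apex below the ancestor of v at depth apex.
  record Cone (v : Vertex) (r : ℕ) : Set where
    constructor cone
    field
      apex up down : ℕ
      depth-v : length v ≡ up + apex
      fits    : down + apex ≤ h
      within  : down + up ≤ r
      level   : T (P (down + apex))

    ancestor : Vertex
    ancestor = take apex v

    ancestor-depth : length ancestor ≡ apex
    ancestor-depth = trans (length-take apex v) (m≤n⇒m⊓n≡m (subst (apex ≤_) (sym depth-v) (m≤n+m apex up)))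

    members : Vertex → Bool
    members = descendantAt ancestor (down + apex)

    members-count : k ^ down ≤ count members (vertices k h)
    members-count = subst (λ n → k ^ n ≤ count members (vertices k h))
      (trans (cong (down + apex ∸_) ancestor-depth) (m+n∸n≡m down apex))
      (descendants-count h ancestor (down + apex) (≤-trans (≤-reflexive ancestor-depth) (m≤n+m apex down)) fits)

    members-depth : ∀ u → T (members u) → length u ≡ down + apex
    members-depth u m = ≡ᵇ⇒≡ (length u) (down + apex) (proj₂ (Equivalence.to T-∧ m))

    members-in-ball : ∀ u → T (members u) → T ((dist v u ≤ᵇ r) ∧ P (length u))
    members-in-ball u m = Equivalence.from T-∧ (≤⇒≤ᵇ close , subst (T ∘ P) (sym u-depth) level)
      where
      u-depth = members-depth u m
      close : dist v u ≤ r
      close = begin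
        dist v u                                                   ≤⟨ dist-≤-through ancestor v u (take-⊑ apex v) (proj₁ (Equivalence.to T-∧ m)) ⟩
        (length v ∸ length ancestor) + (length u ∸ length ancestor) ≡⟨ cong₂ _+_ (cong₂ _∸_ depth-v ancestor-depth) (cong₂ _∸_ u-depth ancestor-depth) ⟩
        (up + apex ∸ apex) + (down + apex ∸ apex)                  ≡⟨ cong₂ _+_ (m+n∸n≡m up apex) (m+n∸n≡m down apex) ⟩
        up + down                                                  ≡⟨ +-comm up down ⟩
        down + up                                                  ≤⟨ within ⟩
        r                                                          ∎
        where open ≤-Reasoning

  open Cone

  cone-count : ∀ {v r} (C : Cone v r) → k ^ down C ≤ ball v r
  cone-count {v} {r} C = ≤-trans (members-count C) (count-mono (members-in-ball C) (vertices k h))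

  cones-count : ∀ {v r} (C D : Cone v r) → down C + apex C ≢ down D + apex D →
    k ^ down C + k ^ down D ≤ ball v r
  cones-count {v} {r} C D levels≢ = ≤-trans (+-mono-≤ (members-count C) (members-count D))
    (count-disjoint disjoint (members-in-ball C) (members-in-ball D) (vertices k h))
    where
    disjoint : ∀ u → T (members C u) → ¬ T (members D u)
    disjoint u mC mD = levels≢ (trans (sym (members-depth C u mC)) (members-depth D u mD))

1+2x≤3^x : ∀ x → suc (x + x) ≤ 3 ^ x
1+2x≤3^x zero    = s≤s z≤n
1+2x≤3^x (suc x) = ≤-trans (m+n≤o⇒m≤o _ (≤-reflexive (identity x))) (*-monoʳ-≤ 3 (1+2x≤3^x x))
  where
  identity : ∀ x → suc (suc x + suc x) + 4 * x ≡ 3 * suc (x + x)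
  identity = solve-∀

2z+2≤3^z : ∀ x → let z = suc (suc x) in suc (suc (z + z)) ≤ 3 ^ z
2z+2≤3^z x = ≤-trans (m+n≤o⇒m≤o _ (≤-reflexive (identity x))) (*-monoʳ-≤ 3 (1+2x≤3^x (suc x)))
  where
  identity : ∀ x → suc (suc (suc (suc x) + suc (suc x))) + (4 * x + 3) ≡ 3 * suc (suc x + suc x)
  identity = solve-∀

3+q≤3^[1+q] : ∀ q → 3 + q ≤ 3 ^ suc q
3+q≤3^[1+q] q = ≤-trans (m+n≤o⇒m≤o _ (≤-reflexive (identity q))) (*-monoʳ-≤ 3 (1+2x≤3^x q))
  where
  identity : ∀ q → 3 + q + 5 * q ≡ 3 * suc (q + q)
  identity = solve-∀

leaf-radius-≤-3^ : ∀ z r → r ≤ suc (suc (z + z)) → r ≢ 2 → r ≢ 4 → r ≤ 3 ^ z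
leaf-radius-≤-3^ zero          r r≤2 r≢2 _   = ≤-pred (≤∧≢⇒< r≤2 r≢2)
leaf-radius-≤-3^ (suc zero)    r r≤4 _   r≢4 = ≤-pred (≤∧≢⇒< r≤4 r≢4)
leaf-radius-≤-3^ (suc (suc x)) r r≤ _  _   = ≤-trans r≤ (2z+2≤3^z x)

-- Climb y of the d steps to the root, as far as radius r allows when the target level lies a
-- below the start: either one more step overshoots, or the root (c = 0) is reached.
climb-split : ∀ a r d → a ≤ r →
  ∃₂ λ c y → c + y ≡ d × a + (y + y) ≤ r × (r ≤ suc (a + (y + y)) ⊎ c ≡ 0)
climb-split a r zero    a≤r = 0 , 0 , refl , subst (_≤ r) (sym (+-identityʳ a)) a≤r , inj₂ refl
climb-split a r (suc d) a≤r with climb-split a r d a≤r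
... | c , y , refl , reach , inj₁ tight = suc c , y , refl , reach , inj₁ tight
... | 0 , y , refl , reach , inj₂ refl with a + (suc y + suc y) ≤? r
...   | yes further = 0 , suc y , refl , further , inj₂ refl
...   | no  short   = 1 , y , refl , reach , inj₁ (≤-pred (subst (r <_) (shift a y) (≰⇒> short)))
  where
  shift : ∀ a y → a + (suc y + suc y) ≡ suc (suc (a + (y + y)))
  shift = solve-∀

-- P marks the depths of S in the tree of height s + 2.
record CoveringLevels (s : ℕ) (P : ℕ → Bool) : Set where
  field
    deepest        : T (P (suc s))
    second-deepest : T (P s)
    window         : ∀ n → n < s → ∃[ j ] j ≤ 2 × T (P (j + n))
    shallow        : T (P 1) ⊎ (T (P 0) × T (P 2))

module _ {k s : ℕ} {P : ℕ → Bool} (3≤k : 3 ≤ k) (L : CoveringLevels s P) where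
  open Tree k
  open Cones k (suc (suc s)) P
  open Cone using (apex; down)
  open CoveringLevels L

  private
    h = suc (suc s)

  by-cone : ∀ {v r} (C : Cone v r) → r ≤ 3 ^ down C → r ≤ ball v r
  by-cone C r≤ = ≤-trans r≤ (≤-trans (^-monoˡ-≤ (down C) 3≤k) (cone-count C))

  by-cones : ∀ {v r} (C D : Cone v r) → down C + apex C ≢ down D + apex D →
    r ≤ 3 ^ down C + 3 ^ down D → r ≤ ball v r
  by-cones C D levels≢ r≤ =
    ≤-trans r≤ (≤-trans (+-mono-≤ (^-monoˡ-≤ (down C) 3≤k) (^-monoˡ-≤ (down D) 3≤k)) (cones-count C D levels≢))

  level-fits : ∀ {j n} → j ≤ 2 → n < s → j + n ≤ h
  level-fits j≤2 n<s = +-mono-≤ j≤2 (<⇒≤ n<s)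

  window-start<s : ∀ e d → d + suc (suc e) ≤ suc s → e + d < s
  window-start<s e d fit = ≤-pred (subst (_≤ suc s) (+-comm d (2 + e)) fit)

  covers-short-radius : ∀ v r → 1 ≤ r → length v + r ≤ suc s → r ≤ ball v r
  covers-short-radius v@[] 1 _ _ with shallow
  ... | inj₁ P1       = by-cone {v} (cone 0 0 1 refl (s≤s z≤n) ≤-refl P1) (s≤s z≤n)
  ... | inj₂ (P0 , _) = by-cone {v} (cone 0 0 0 refl z≤n z≤n P0) ≤-refl
  covers-short-radius v@[] 2 _ _ with shallow
  ... | inj₁ P1       = by-cone {v} (cone 0 0 1 refl (s≤s z≤n) (s≤s z≤n) P1) (s≤s (s≤s z≤n))
  ... | inj₂ (_ , P2) = by-cone {v} (cone 0 0 2 refl (s≤s (s≤s z≤n)) ≤-refl P2) (s≤s (s≤s z≤n))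
  covers-short-radius v@(a ∷ w) 1 _ fit with window-start<s 0 (length w) (≤-trans (≤-reflexive (+-suc (length w) 1)) fit)
  ... | n<s with window (length w) n<s
  ... | 0 , j≤2 , Pn = by-cone {v} (cone (length w) 1 0 refl (level-fits j≤2 n<s) ≤-refl Pn) ≤-refl
  ... | 1 , j≤2 , Pn = by-cone {v} (cone (suc (length w)) 0 0 refl (level-fits j≤2 n<s) z≤n Pn) ≤-refl
  ... | 2 , j≤2 , Pn = by-cone {v} (cone (suc (length w)) 0 1 refl (level-fits j≤2 n<s) ≤-refl Pn) (s≤s z≤n)
  ... | suc (suc (suc _)) , s≤s (s≤s ()) , _
  covers-short-radius v@(a ∷ w) 2 _ fit with window-start<s 0 (length v) fit
  ... | d<s with window (length v) d<s
  ... | 0 , j≤2 , Pn = by-cone {v} (cone (length w) 1 1 refl (level-fits j≤2 d<s) ≤-refl Pn) (s≤s (s≤s z≤n))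
  ... | 1 , j≤2 , Pn = by-cone {v} (cone (length v) 0 1 refl (level-fits j≤2 d<s) (s≤s z≤n) Pn) (s≤s (s≤s z≤n))
  ... | 2 , j≤2 , Pn = by-cone {v} (cone (length v) 0 2 refl (level-fits j≤2 d<s) ≤-refl Pn) (s≤s (s≤s z≤n))
  ... | suc (suc (suc _)) , s≤s (s≤s ()) , _
  covers-short-radius v (suc (suc (suc q))) _ fit with window-start<s (suc q) (length v) fit
  ... | n<s with window (suc q + length v) n<s
  ... | j , j≤2 , Pn = by-cone {v} (cone (length v) 0 (j + suc q) refl fits within level) bound
    where
    assoc : j + suc q + length v ≡ j + (suc q + length v)
    assoc = +-assoc j (suc q) (length v)
    fits : j + suc q + length v ≤ h
    fits = ≤-trans (≤-reflexive assoc) (level-fits j≤2 n<s)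
    within : j + suc q + 0 ≤ 3 + q
    within = ≤-trans (≤-reflexive (+-identityʳ _)) (+-monoˡ-≤ (suc q) j≤2)
    level : T (P (j + suc q + length v))
    level = subst (T ∘ P) (sym assoc) Pn
    bound : 3 + q ≤ 3 ^ (j + suc q)
    bound = ≤-trans (3+q≤3^[1+q] q) (^-monoʳ-≤ 3 (m≤n+m (suc q) j))

  covers-reaching-deepest : ∀ v r → length v ≤ suc s → h ≤ length v + r → r ≤ length v + h → r ≤ ball v r
  covers-reaching-deepest v r v-inner reach r≤ with m≤n⇒∃[o]m+o≡n v-inner
  ... | a , d+a≡deepest with climb-split a r (length v) a≤r
    where
    a≤r : a ≤ r
    a≤r = <⇒≤ (+-cancelˡ-≤ (length v) (suc a) r (subst (_≤ length v + r) (trans (cong suc (sym d+a≡deepest)) (sym (+-suc _ a))) reach))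
  ... | c , y , c+y≡d , climb≤r , tight =
    by-cone {v} (cone c y (a + y) (trans (sym c+y≡d) (+-comm c y)) in-tree in-ball at-deepest) (≤-trans (r≤2x+1 tight) (1+2x≤3^x (a + y)))
    where
    d = length v
    level≡deepest : a + y + c ≡ suc s
    level≡deepest = begin
      a + y + c   ≡⟨ +-assoc a y c ⟩
      a + (y + c) ≡⟨ cong (a +_) (trans (+-comm y c) c+y≡d) ⟩
      a + d       ≡⟨ +-comm a d ⟩
      d + a       ≡⟨ d+a≡deepest ⟩
      suc s       ∎
      where open ≡-Reasoning
    in-tree : a + y + c ≤ h
    in-tree = ≤-trans (≤-reflexive level≡deepest) (n≤1+n _)
    in-ball : a + y + y ≤ r
    in-ball = subst (_≤ r) (sym (+-assoc a y y)) climb≤r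
    at-deepest : T (P (a + y + c))
    at-deepest = subst (T ∘ P) (sym level≡deepest) deepest
    r≤2x+1 : r ≤ suc (a + (y + y)) ⊎ c ≡ 0 → r ≤ suc ((a + y) + (a + y))
    r≤2x+1 (inj₁ r≤1+a+2y) = ≤-trans r≤1+a+2y (s≤s (m+n≤o⇒m≤o _ (≤-reflexive (identity a y))))
      where
      identity : ∀ a y → a + (y + y) + a ≡ (a + y) + (a + y)
      identity = solve-∀
    r≤2x+1 (inj₂ c≡0) = begin
      r                            ≤⟨ r≤ ⟩
      d + suc (suc s)              ≡⟨ cong (λ e → d + suc e) (sym d+a≡deepest) ⟩
      d + suc (d + a)              ≤⟨ m≤m+n _ a ⟩
      d + suc (d + a) + a          ≡⟨ identity d a ⟩
      suc ((a + d) + (a + d))      ≡⟨ cong (λ e → suc ((a + e) + (a + e))) (sym (trans (cong (_+ y) (sym c≡0)) c+y≡d)) ⟩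
      suc ((a + y) + (a + y))      ∎
      where
      open ≤-Reasoning
      identity : ∀ d a → d + suc (d + a) + a ≡ suc ((a + d) + (a + d))
      identity = solve-∀

  covers-leaf-by-climbing : ∀ v r → length v ≡ h → 1 ≤ r → r ≤ length v + h → r ≢ 2 → r ≢ 4 → r ≤ ball v r
  covers-leaf-by-climbing v r leaf 1≤r r≤ r≢2 r≢4 with climb-split 1 r (suc s) 1≤r
  ... | c , z , c+z≡deepest , climb≤r , tight =
    by-cone {v} (cone c (suc z) z v-depth in-tree in-ball at-deepest) (leaf-radius-≤-3^ z r (r≤2z+2 tight) r≢2 r≢4)
    where
    level≡deepest : z + c ≡ suc s
    level≡deepest = trans (+-comm z c) c+z≡deepest
    v-depth : length v ≡ suc z + c
    v-depth = trans leaf (cong suc (sym level≡deepest))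
    in-tree : z + c ≤ h
    in-tree = ≤-trans (≤-reflexive level≡deepest) (n≤1+n _)
    in-ball : z + suc z ≤ r
    in-ball = subst (_≤ r) (sym (+-suc z z)) climb≤r
    at-deepest : T (P (z + c))
    at-deepest = subst (T ∘ P) (sym level≡deepest) deepest
    r≤2z+2 : r ≤ suc (suc (z + z)) ⊎ c ≡ 0 → r ≤ suc (suc (z + z))
    r≤2z+2 (inj₁ r≤2z+2) = r≤2z+2
    r≤2z+2 (inj₂ c≡0) = begin
      r                             ≤⟨ r≤ ⟩
      length v + h                  ≡⟨ cong (_+ h) leaf ⟩
      suc (suc (s + suc (suc s)))   ≡⟨ cong (suc ∘ suc) (+-suc s (suc s)) ⟩
      suc (suc (suc s + suc s))     ≡⟨ cong (λ e → suc (suc (e + e))) (sym (trans (cong (_+ z) (sym c≡0)) c+z≡deepest)) ⟩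
      suc (suc (z + z))             ∎
      where open ≤-Reasoning

  covers-leaf : ∀ v r → length v ≡ h → 1 ≤ r → r ≤ length v + h → r ≤ ball v r
  covers-leaf v r leaf 1≤r r≤ with r ≟ 2 | r ≟ 4
  ... | yes refl | _ = by-cones {v} (cone (suc s) 1 0 leaf (n≤1+n _) (s≤s z≤n) deepest)
                                    (cone s 2 0 leaf (≤-trans (n≤1+n s) (n≤1+n _)) ≤-refl second-deepest) 1+n≢n ≤-refl
  ... | no _ | yes refl = by-cones {v} (cone s 2 1 leaf (n≤1+n _) (s≤s (s≤s (s≤s z≤n))) deepest)
                                       (cone s 2 0 leaf (≤-trans (n≤1+n s) (n≤1+n _)) (s≤s (s≤s z≤n)) second-deepest) 1+n≢n ≤-refl
  ... | no r≢2 | no r≢4 = covers-leaf-by-climbing v r leaf 1≤r r≤ r≢2 r≢4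

  multicover-from-levels : IsMulticover k h (λ u → P (length u))
  multicover-from-levels v v≤h r 1≤r r≤ecc with m≤n⇒m<n∨m≡n v≤h | ≤-trans r≤ecc (ecc-≤ h v)
  ... | inj₂ leaf            | r≤ = covers-leaf v r leaf 1≤r r≤
  ... | inj₁ (s≤s v-inner) | r≤ with h ≤? length v + r
  ...   | yes reach = covers-reaching-deepest v r v-inner reach r≤
  ...   | no  short = covers-short-radius v r 1≤r (≤-pred (≰⇒> short))

residue-offset : ∀ e → ∃₂ λ q j → j ≤ 2 × j + e ≡ suc (suc (q * 3))
residue-offset zero = 0 , 2 , ≤-refl , refl
residue-offset (suc e) with residue-offset e
... | q , 0     , _         , refl = suc q , 2 , ≤-refl , refl
... | q , suc j , s≤s j≤1   , j+e≡ = q , j , m≤n⇒m≤1+n j≤1 , trans (+-suc j e) j+e≡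

q*3≤1+m*3⇒q≤m : ∀ q m → q * 3 ≤ suc (m * 3) → q ≤ m
q*3≤1+m*3⇒q≤m q m le = ≤-pred (*-cancelʳ-< 3 q (suc m) (s≤s (≤-trans le (n≤1+n _))))

-- The set S of the theorem for h = 3 (m + 1) + t; s t = h - 2.
module PaperLevels (m : ℕ) where
  s : ℕ → ℕ
  s t = suc t + m * 3

  P : ℕ → ℕ → Bool
  P t = inS-depth (suc (suc (s t))) t

  main-level : ∀ t q → q ≤ m → T (P t (suc t + q * 3))
  main-level t q q≤m = Equivalence.from (T-∨ {suc t + q * 3 ≡ᵇ suc (s t)}) (inj₂ (Equivalence.from T-∨ (inj₁ (Equivalence.from T-∧
    (≤⇒≤ᵇ (m≤m+n (suc t) (q * 3)) , Equivalence.from T-∧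
    (≤⇒≤ᵇ (+-monoʳ-≤ (suc t) (*-monoˡ-≤ 3 q≤m)) ,
     ≡⇒≡ᵇ _ _ (trans ([m+kn]%n≡m%n (suc t) q 3) (sym ([m+kn]%n≡m%n (suc t) m 3)))))))))

  deepest : ∀ t → T (P t (suc (s t)))
  deepest t = Equivalence.from T-∨ (inj₁ (≡⇒≡ᵇ (suc (s t)) (suc (s t)) refl))

  shallow : ∀ t → t ≤ 2 → T (P t 1) ⊎ (T (P t 0) × T (P t 2))
  shallow 0 _ = inj₁ (main-level 0 0 z≤n)
  shallow 1 _ = inj₂ (tt , main-level 1 0 z≤n)
  shallow 2 _ = inj₁ tt
  shallow (suc (suc (suc _))) (s≤s (s≤s ()))

  window-before-first-main : ∀ {t n} → t ≤ 2 → suc n < t → ∃[ j ] j ≤ 2 × T (P t (j + n))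
  window-before-first-main (s≤s (s≤s z≤n)) (s≤s (s≤s z≤n)) = 1 , s≤s z≤n , tt

  window : ∀ t → t ≤ 2 → ∀ n → n < s t → ∃[ j ] j ≤ 2 × T (P t (j + n))
  window t t≤2 n n<s with t ≤? suc n
  ... | no  t≰1+n = window-before-first-main t≤2 (≰⇒> t≰1+n)
  ... | yes t≤1+n with m≤n⇒∃[o]m+o≡n t≤1+n
  ... | e , t+e≡1+n with residue-offset e
  ... | q , j , j≤2 , j+e≡ = j , j≤2 , subst (T ∘ P t) (sym level≡) (main-level t q q≤m)
    where
    level≡ : j + n ≡ suc t + q * 3
    level≡ = suc-injective (begin
      suc (j + n)           ≡⟨ sym (+-suc j n) ⟩
      j + suc n             ≡⟨ cong (j +_) (sym t+e≡1+n) ⟩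
      j + (t + e)           ≡⟨ swap j t e ⟩
      t + (j + e)           ≡⟨ cong (t +_) j+e≡ ⟩
      t + suc (suc (q * 3)) ≡⟨ +-suc t (suc (q * 3)) ⟩
      suc (t + suc (q * 3)) ≡⟨ cong suc (+-suc t (q * 3)) ⟩
      suc (suc t + q * 3)   ∎)
      where
      open ≡-Reasoning
      swap : ∀ j t e → j + (t + e) ≡ t + (j + e)
      swap = solve-∀
    q≤m : q ≤ m
    q≤m = q*3≤1+m*3⇒q≤m q m (+-cancelˡ-≤ (suc t) (q * 3) (suc (m * 3)) (begin
      suc t + q * 3         ≡⟨ level≡ ⟨
      j + n                 ≤⟨ +-monoˡ-≤ n j≤2 ⟩
      suc (suc n)           ≤⟨ s≤s n<s ⟩
      suc (s t)             ≡⟨ +-suc (suc t) (m * 3) ⟨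
      suc t + suc (m * 3)   ∎))
      where open ≤-Reasoning

  layered : ∀ t → t ≤ 2 → CoveringLevels (s t) (P t)
  layered t t≤2 = record
    { deepest        = deepest t
    ; second-deepest = main-level t m ≤-refl
    ; window         = window t t≤2
    ; shallow        = shallow t t≤2
    }

mainTheorem9 : (k m t : ℕ) → 3 ≤ k → t ≤ 2 → 3 ≤ 3 * m + t →
    IsMulticover k (3 * m + t) (theSet k (3 * m + t) t)
mainTheorem9 k zero    t 3≤k t≤2 3≤t = ⊥-elim (≤⇒≯ t≤2 3≤t)
mainTheorem9 k (suc m) t 3≤k t≤2 _   =
  subst (λ h → IsMulticover k h (theSet k h t)) (sym (height t m)) (multicover-from-levels 3≤k (PaperLevels.layered m t t≤2))
  where
  height : ∀ t m → 3 * suc m + t ≡ suc (suc (suc t + m * 3))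
  height = solve-∀
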